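{- Let $k\ge 1$ and $a\ge 1$ be integers, and let $G$ be a simple graph that is degree equivalent to the complete $k$-partite graph $K_{a,\ldots,a}$ (with $k$ parts each of size $a$). Then $\omega(G)=k$ if and only if $G$ is isomorphic to $K_{a,\ldots,a}$.
   Context: All graphs are finite simple graphs. Two graphs are degree equivalent if they have the same multiset of vertex degrees. $\omega(G)$ is the clique number of $G$. $K_{a,\ldots,a}$ is the complete $k$-partite graph with $k$ independent parts of size $a$, any two vertices in different parts being adjacent. -}

module Defs where

open import Data.Nat using (ℕ; _≤_)
open import Data.Bool using (Bool; true; false; not)
open import Data.Fin using (Fin; quotient)
open import Data.Fin.Properties using (_≟_)
open import Data.List using (List; length; map; filter)
open import Data.List.Relation.Unary.AllPairs using (AllPairs)
open import Data.List.Relation.Binary.Permutation.Propositional using (_↭_)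
open import Data.Product using (Σ; _×_; ∃-syntax)
open import Data.Vec.Functional using (toList)
open import Data.Vec.Functional using ()
open import Function.Bundles using (_⤖_; Bijection)
open import Relation.Binary.PropositionalEquality using (_≡_)
open import Relation.Nullary.Decidable using (⌊_⌋)
open import Data.List using (allFin)
open import Data.Bool using (T)

record Graph (n : ℕ) : Set where
  field
    adj   : Fin n → Fin n → Bool
    adj-sym : ∀ i j → adj i j ≡ adj j i
    adj-irrefl : ∀ i → adj i i ≡ false
open Graph public

degree : ∀ {n} → Graph n → Fin n → ℕ
degree {n} G i = length (filter (λ j → T? (adj G i j)) (allFin n))
  where
  open import Data.Bool.Properties using (T?)

degreeList : ∀ {n} → Graph n → List ℕ
degreeList {n} G = map (degree G) (allFin n)

DegreeEquivalent : ∀ {n m} → Graph n → Graph m → Set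
DegreeEquivalent G H = degreeList G ↭ degreeList H

IsClique : ∀ {n} → Graph n → List (Fin n) → Set
IsClique G vs = AllPairs (λ u v → adj G u v ≡ true) vs

CliqueNumber≡ : ∀ {n} → Graph n → ℕ → Set
CliqueNumber≡ G k =
  (Σ (List _) λ vs → IsClique G vs × length vs ≡ k)
  × (∀ vs → IsClique G vs → length vs ≤ k)

Isomorphic : ∀ {n m} → Graph n → Graph m → Set
Isomorphic {n} {m} G H =
  Σ (Fin n ⤖ Fin m) λ f →
    ∀ i j → adj G i j ≡ adj H (Bijection.to f i) (Bijection.to f j)

-- complete k-partite graph K_{a,...,a}: vertices Fin (k * a),
-- vertex i lies in part (quotient a i) : Fin k; adjacent iff parts differ
completeMultipartite : (k a : ℕ) → Graph (k Data.Nat.* a)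
completeMultipartite k a = record
  { adj = λ i j → not ⌊ quotient {k} a i ≟ quotient {k} a j ⌋
  ; adj-sym = λ i j → symP i j
  ; adj-irrefl = λ i → irr i
  }
  where
  open import Relation.Nullary using (yes; no)
  open import Relation.Binary.PropositionalEquality using (refl; sym)
  open import Relation.Nullary using (contradiction)
  symP : ∀ i j → not ⌊ quotient {k} a i ≟ quotient {k} a j ⌋ ≡ not ⌊ quotient {k} a j ≟ quotient {k} a i ⌋
  symP i j with quotient {k} a i ≟ quotient {k} a j | quotient {k} a j ≟ quotient {k} a i
  ... | yes _ | yes _ = refl
  ... | no _ | no _ = refl
  ... | yes p | no q = contradiction (sym p) q
  ... | no p | yes q = contradiction (sym q) p
  irr : ∀ i → not ⌊ quotient {k} a i ≟ quotient {k} a i ⌋ ≡ false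
  irr i with quotient {k} a i ≟ quotient {k} a i
  ... | yes _ = refl
  ... | no p = contradiction refl p

-- Degree equivalence with K_{a,…,a} says that G has n = ka vertices, each with exactly a
-- non-neighbours (itself included). Fix a k-clique c of G. Every vertex misses some c i, since
-- otherwise c would extend to a larger clique; and the non-adjacent pairs (c i, v) number k·a = n,
-- so every vertex misses exactly one c i, whose index we call its class. Putting u into c in place
-- of the vertex of its class yields another k-clique, and uniqueness of the missed vertex in both
-- cliques shows that two vertices are non-adjacent exactly when they share a class. Each class is
-- the non-neighbourhood of its clique vertex, so has a elements, and numbering the vertices inside
-- their classes gives the isomorphism. Conversely ω(K_{a,…,a}) = k, and isomorphisms preserve ω.
module Submission where

open import Defs
open import Data.Nat using (ℕ; zero; suc; _+_; _*_; _≤_; _<_; z≤n; s≤s)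
open import Data.Nat.Properties
  using (+-0-commutativeMonoid; +-assoc; +-mono-≤; +-mono-<-≤; +-mono-≤-<; +-cancelˡ-≡;
         *-zeroʳ; *-identityʳ; ≤-refl; ≤-reflexive; ≤-trans; ≤-antisym; <-irrefl; <⇒≱; <⇒≢; ≮⇒≥;
         <-≤-trans)
open import Data.Bool using (true; false; not; if_then_else_; T)
open import Data.Bool.Properties using (T?; ¬-not) renaming (_≟_ to _≟ᵇ_)
open import Data.Fin using (Fin; zero; suc; _↑ˡ_; _↑ʳ_; toℕ; combine; quotient; fromℕ<)
open import Data.Fin.Properties
  using (_≟_; _<?_; any?; remQuot-combine; combine-injective; toℕ-fromℕ<; injective⇒≤;
         punchOut-injective; suc-injective)
  renaming (<-irrefl to <ᶠ-irrefl; <-trans to <ᶠ-trans; <-cmp to <ᶠ-cmp)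
import Data.Fin as Fin
open import Data.List using (List; _∷_; length; map; filter; tabulate; lookup; allFin)
open import Data.List.Properties using (length-map; length-tabulate)
open import Data.List.Relation.Unary.AllPairs using (AllPairs; _∷_)
import Data.List.Relation.Unary.AllPairs as AllPairs
import Data.List.Relation.Unary.AllPairs.Properties as AllPairs
import Data.List.Relation.Unary.All as All
import Data.List.Relation.Unary.All.Properties as Allₚ
open import Data.List.Membership.Propositional.Properties using (∈-map⁺; ∈-map⁻; ∈-allFin; ∈-lookup)
open import Data.List.Relation.Binary.Permutation.Propositional.Properties using (∈-resp-↭; ↭-length)
open import Data.Product using (_×_; _,_; proj₁; proj₂; ∃-syntax)
open import Data.Vec.Functional using (updateAt)
open import Data.Vec.Functional.Properties using (updateAt-updates; updateAt-minimal)
open import Function using (_∘_; id; const; case_of_; _⇔_; mk⇔; Equivalence)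
open import Function.Bundles using (mk⤖; Bijection)
open import Function.Definitions using (Injective; StrictlySurjective)
open import Function.Consequences.Propositional using (strictlySurjective⇒surjective)
open import Relation.Binary using (Symmetric; tri<; tri≈; tri>)
open import Relation.Binary.PropositionalEquality
open import Relation.Nullary using (Dec; yes; no; ¬_; ¬?; contradiction; does; _×-dec_)
open import Relation.Nullary.Decidable using (⌊_⌋; dec-no; does-⇔)
open import Level using (0ℓ)
open import Relation.Unary using (Pred; Decidable; _⊆_)
open import Relation.Unary.Properties using (∁?)
open import Algebra.Properties.CommutativeMonoid.Sum +-0-commutativeMonoid
  using (sum; sum-syntax; sum-cong-≗; ∑-comm; ∑-distrib-+)

private
  variable
    n m k : ℕ

∑-const : ∀ n c → ∑[ i < n ] c ≡ n * c
∑-const zero    c = refl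
∑-const (suc n) c = cong (c +_) (∑-const n c)

∑-mono-≤ : {f g : Fin n → ℕ} → (∀ i → f i ≤ g i) → sum f ≤ sum g
∑-mono-≤ {zero}  f≤g = z≤n
∑-mono-≤ {suc n} f≤g = +-mono-≤ (f≤g zero) (∑-mono-≤ (f≤g ∘ suc))

∑-mono-< : {f g : Fin n → ℕ} → (∀ i → f i ≤ g i) → ∀ i → f i < g i → sum f < sum g
∑-mono-< {suc n} f≤g zero    fi<gi = +-mono-<-≤ fi<gi (∑-mono-≤ (f≤g ∘ suc))
∑-mono-< {suc n} f≤g (suc i) fi<gi = +-mono-≤-< (f≤g zero) (∑-mono-< (f≤g ∘ suc) i fi<gi)

∑-≤-rigid : {f g : Fin n → ℕ} → (∀ i → f i ≤ g i) → sum g ≤ sum f → ∀ i → f i ≡ g i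
∑-≤-rigid f≤g ∑g≤∑f i = ≤-antisym (f≤g i) (≮⇒≥ λ fi<gi → <⇒≱ (∑-mono-< f≤g i fi<gi) ∑g≤∑f)

∑-↑ : ∀ m n (f : Fin (m + n) → ℕ) → sum f ≡ sum (f ∘ (_↑ˡ n)) + sum (f ∘ (m ↑ʳ_))
∑-↑ zero    n f = refl
∑-↑ (suc m) n f = trans (cong (f zero +_) (∑-↑ m n (f ∘ suc))) (sym (+-assoc (f zero) _ _))

∑-combine : ∀ m n (f : Fin (m * n) → ℕ) → sum f ≡ ∑[ i < m ] ∑[ j < n ] f (combine i j)
∑-combine zero    n f = refl
∑-combine (suc m) n f =
  trans (∑-↑ n (m * n) f) (cong (sum (f ∘ (_↑ˡ m * n)) +_) (∑-combine m n (f ∘ (n ↑ʳ_))))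

indicator : {A : Set} → Dec A → ℕ
indicator a? = if does a? then 1 else 0

indicator-mono : {A B : Set} (a? : Dec A) (b? : Dec B) → (A → B) → indicator a? ≤ indicator b?
indicator-mono (yes _) (yes _) _   = ≤-refl
indicator-mono (yes a) (no ¬b) a→b = contradiction (a→b a) ¬b
indicator-mono (no _)  _       _   = z≤n

indicator-< : {A B : Set} (a? : Dec A) (b? : Dec B) → ¬ A → B → indicator a? < indicator b?
indicator-< (yes a) _       ¬a _ = contradiction a ¬a
indicator-< (no _)  (yes _) _  _ = s≤s z≤n
indicator-< (no _)  (no ¬b) _  b = contradiction b ¬b

indicator-+-∁ : {A : Set} (a? : Dec A) → indicator a? + indicator (¬? a?) ≡ 1
indicator-+-∁ (yes _) = refl
indicator-+-∁ (no _)  = refl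

-- Opaque, so that unification compares count P? by its predicate rather than unfolding the sum.
opaque
  count : {P : Pred (Fin n) 0ℓ} → Decidable P → ℕ
  count P? = sum (indicator ∘ P?)

  count-suc : {P : Pred (Fin (suc n)) 0ℓ} (P? : Decidable P) →
              count P? ≡ indicator (P? zero) + count (P? ∘ suc)
  count-suc P? = refl

  count-cong : {P Q : Pred (Fin n) 0ℓ} {P? : Decidable P} {Q? : Decidable Q} →
               (∀ x → P x ⇔ Q x) → count P? ≡ count Q?
  count-cong {P? = P?} {Q? = Q?} P⇔Q =
    sum-cong-≗ λ x → cong (λ b → if b then 1 else 0) (does-⇔ (P⇔Q x) (P? x) (Q? x))

  count-mono : {P Q : Pred (Fin n) 0ℓ} {P? : Decidable P} {Q? : Decidable Q} →
               P ⊆ Q → count P? ≤ count Q?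
  count-mono {P? = P?} {Q? = Q?} P⊆Q = ∑-mono-≤ λ x → indicator-mono (P? x) (Q? x) P⊆Q

  count-mono-< : {P Q : Pred (Fin n) 0ℓ} {P? : Decidable P} {Q? : Decidable Q} →
                 P ⊆ Q → ∀ {i} → ¬ P i → Q i → count P? < count Q?
  count-mono-< {P? = P?} {Q? = Q?} P⊆Q {i} ¬Pi Qi =
    ∑-mono-< (λ x → indicator-mono (P? x) (Q? x) P⊆Q) i (indicator-< (P? i) (Q? i) ¬Pi Qi)

  count-+-∁ : {P : Pred (Fin n) 0ℓ} (P? : Decidable P) → count P? + count (∁? P?) ≡ n
  count-+-∁ {n = n} P? = begin
    count P? + count (∁? P?)
      ≡⟨ ∑-distrib-+ (indicator ∘ P?) (indicator ∘ ∁? P?) ⟨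
    ∑[ x < n ] (indicator (P? x) + indicator (¬? (P? x)))
      ≡⟨ sum-cong-≗ (indicator-+-∁ ∘ P?) ⟩
    ∑[ x < n ] 1
      ≡⟨ ∑-const n 1 ⟩
    n * 1
      ≡⟨ *-identityʳ n ⟩
    n ∎
    where open ≡-Reasoning

  count-∅ : {P : Pred (Fin n) 0ℓ} (P? : Decidable P) → (∀ x → ¬ P x) → count P? ≡ 0
  count-∅ {n = n} P? ¬P =
    trans (sum-cong-≗ λ x → cong indicator (dec-no (P? x) (¬P x))) (trans (∑-const n 0) (*-zeroʳ n))

  ∑-count-comm : {R : Fin m → Fin n → Set} (R? : ∀ i j → Dec (R i j)) →
                 ∑[ i < m ] count (R? i) ≡ ∑[ j < n ] count (λ i → R? i j)
  ∑-count-comm R? = ∑-comm (λ i j → indicator (R? i j))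

  count-combine : {P : Pred (Fin (m * n)) 0ℓ} (P? : Decidable P) →
                  count P? ≡ ∑[ i < m ] count (P? ∘ combine i)
  count-combine {m = m} {n = n} P? = ∑-combine m n (indicator ∘ P?)

count-≡ : (i : Fin n) → count (_≟ i) ≡ 1
count-≡ {suc n} zero    = trans (count-suc (_≟ zero)) (cong suc (count-∅ (λ x → suc x ≟ zero) λ _ ()))
count-≡ {suc n} (suc i) = begin
  count (_≟ suc i)                 ≡⟨ count-suc (_≟ suc i) ⟩
  count (λ x → suc x ≟ suc i)      ≡⟨ count-cong (λ x → mk⇔ suc-injective (cong suc)) ⟩
  count (_≟ i)                     ≡⟨ count-≡ i ⟩
  1                                ∎
  where open ≡-Reasoning

count-pos : {P : Pred (Fin n) 0ℓ} {P? : Decidable P} → ∀ {i} → P i → 1 ≤ count P?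
count-pos {i = i} Pi = ≤-trans (≤-reflexive (sym (count-≡ i))) (count-mono λ { refl → Pi })

count≤1⇒unique : {P : Pred (Fin n) 0ℓ} {P? : Decidable P} →
                 count P? ≤ 1 → ∀ {i j} → P i → P j → i ≡ j
count≤1⇒unique count≤1 {i} {j} Pi Pj with i ≟ j
... | yes i≡j = i≡j
... | no  i≢j = contradiction (<-≤-trans (count-mono-< (λ { refl → Pi }) (i≢j ∘ sym) Pj) count≤1)
                  (<-irrefl (count-≡ i))

-- The non-neighbourhood of u includes u itself.
coDegree : Graph n → Fin n → ℕ
coDegree G u = count (λ v → adj G u v ≟ᵇ false)

length-filter-tabulate : {A : Set} {P : Pred A 0ℓ} (P? : Decidable P) (f : Fin n → A) →
                         length (filter P? (tabulate f)) ≡ count (P? ∘ f)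
length-filter-tabulate {zero}  P? f = sym (count-∅ (P? ∘ f) λ ())
length-filter-tabulate {suc n} P? f rewrite count-suc (P? ∘ f) with P? (f zero)
... | yes _ = cong suc (length-filter-tabulate P? (f ∘ suc))
... | no  _ = length-filter-tabulate P? (f ∘ suc)

degree+coDegree : (G : Graph n) (u : Fin n) → degree G u + coDegree G u ≡ n
degree+coDegree {n} G u = begin
  degree G u + coDegree G u
    ≡⟨ cong (_+ coDegree G u) (length-filter-tabulate (T? ∘ adj G u) id) ⟩
  count (T? ∘ adj G u) + coDegree G u
    ≡⟨ cong (count (T? ∘ adj G u) +_) (count-cong λ v → ¬T⇔≡false) ⟨
  count (T? ∘ adj G u) + count (∁? (T? ∘ adj G u))
    ≡⟨ count-+-∁ (T? ∘ adj G u) ⟩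
  n ∎
  where
  open ≡-Reasoning
  ¬T⇔≡false : ∀ {b} → (¬ T b) ⇔ b ≡ false
  ¬T⇔≡false {false} = mk⇔ (const refl) (const λ ())
  ¬T⇔≡false {true}  = mk⇔ (λ ¬⊤ → contradiction _ ¬⊤) λ ()

module _ (G : Graph n) (H : Graph m) (G≈H : DegreeEquivalent G H) where

  degreeEquivalent⇒order≡ : n ≡ m
  degreeEquivalent⇒order≡ = begin
    n                     ≡⟨ length-tabulate {n = n} id ⟨
    length (allFin n)     ≡⟨ length-map (degree G) (allFin n) ⟨
    length (degreeList G) ≡⟨ ↭-length G≈H ⟩
    length (degreeList H) ≡⟨ length-map (degree H) (allFin m) ⟩
    length (allFin m)     ≡⟨ length-tabulate {n = m} id ⟩
    m                     ∎
    where open ≡-Reasoning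

  degreeEquivalent⇒coDegree : ∀ u → ∃[ v ] coDegree G u ≡ coDegree H v
  degreeEquivalent⇒coDegree u
    with v , _ , deg-u≡deg-v ← ∈-map⁻ (degree H) (∈-resp-↭ G≈H (∈-map⁺ (degree G) (∈-allFin u))) =
    v , +-cancelˡ-≡ (degree G u) _ _ (begin
    degree G u + coDegree G u ≡⟨ degree+coDegree G u ⟩
    n                         ≡⟨ degreeEquivalent⇒order≡ ⟩
    m                         ≡⟨ degree+coDegree H v ⟨
    degree H v + coDegree H v ≡⟨ cong (_+ coDegree H v) deg-u≡deg-v ⟨
    degree G u + coDegree H v ∎)
    where open ≡-Reasoning

IsCliqueMap : Graph n → (Fin k → Fin n) → Set
IsCliqueMap G c = ∀ i j → i ≢ j → adj G (c i) (c j) ≡ true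

allPairs-lookup : {A : Set} {R : A → A → Set} {xs : List A} → Symmetric R → AllPairs R xs →
                  ∀ {i j} → i ≢ j → R (lookup xs i) (lookup xs j)
allPairs-lookup sym-R (_  ∷ _)   {zero}  {zero}  0≢0 = contradiction refl 0≢0
allPairs-lookup sym-R (Rx ∷ _)   {zero}  {suc j} _   = All.lookup Rx (∈-lookup j)
allPairs-lookup sym-R (Rx ∷ _)   {suc i} {zero}  _   = sym-R (All.lookup Rx (∈-lookup i))
allPairs-lookup sym-R (_  ∷ Rxs) {suc i} {suc j} i≢j = allPairs-lookup sym-R Rxs (i≢j ∘ cong suc)

distinct⇒length≤ : (xs : List (Fin k)) → AllPairs _≢_ xs → length xs ≤ k
distinct⇒length≤ xs distinct = injective⇒≤ {f = lookup xs} λ {i} {j} xᵢ≡xⱼ → case i ≟ j of λ where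
  (yes i≡j) → i≡j
  (no  i≢j) → contradiction xᵢ≡xⱼ (allPairs-lookup (_∘ sym) distinct i≢j)

module _ (G : Graph n) where

  lookup-isCliqueMap : ∀ {vs} → IsClique G vs → IsCliqueMap G (lookup vs)
  lookup-isCliqueMap vs-clique i j =
    allPairs-lookup (λ {u} {v} uv-adjacent → trans (adj-sym G v u) uv-adjacent) vs-clique

  tabulate-isClique : ∀ {c : Fin k → Fin n} → IsCliqueMap G c → IsClique G (tabulate c)
  tabulate-isClique c-clique = AllPairs.tabulate⁺ (c-clique _ _)

isClique-map : (G : Graph n) (H : Graph m) (f : Fin n → Fin m) →
               (∀ u v → adj G u v ≡ adj H (f u) (f v)) → ∀ {vs} → IsClique G vs → IsClique H (map f vs)
isClique-map G H f f-adj = AllPairs.map⁺ ∘ AllPairs.map λ {u} {v} → trans (sym (f-adj u v))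

module _ (G : Graph n) (H : Graph m) (G≅H : Isomorphic G H) where

  private
    open Bijection (proj₁ G≅H) using (to; strictlySurjective)

    from : Fin m → Fin n
    from y = proj₁ (strictlySurjective y)

    to-from : ∀ y → to (from y) ≡ y
    to-from y = proj₂ (strictlySurjective y)

    adj-to : ∀ u v → adj G u v ≡ adj H (to u) (to v)
    adj-to = proj₂ G≅H

    adj-from : ∀ x y → adj H x y ≡ adj G (from x) (from y)
    adj-from x y = sym (trans (adj-to (from x) (from y)) (cong₂ (adj H) (to-from x) (to-from y)))

  isomorphic⇒cliqueNumber≡ : ∀ {k} → CliqueNumber≡ H k → CliqueNumber≡ G k
  isomorphic⇒cliqueNumber≡ ((ws , ws-clique , |ws|≡k) , H-bound) =
    (map from ws , isClique-map H G from adj-from ws-clique , trans (length-map from ws) |ws|≡k) ,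
    λ vs vs-clique → subst (_≤ _) (length-map to vs) (H-bound (map to vs) (isClique-map G H to adj-to vs-clique))

exchange-isCliqueMap : (G : Graph n) {c : Fin k → Fin n} {i : Fin k} {u : Fin n} →
                       IsCliqueMap G c → (∀ j → j ≢ i → adj G (c j) u ≡ true) →
                       IsCliqueMap G (updateAt c i (const u))
exchange-isCliqueMap G {c} {i} {u} c-clique u-adjacent j l j≢l with j ≟ i | l ≟ i
... | yes refl | yes refl = contradiction refl j≢l
... | yes refl | no  l≢i
  rewrite updateAt-updates i {const u} c | updateAt-minimal l i {const u} c l≢i =
  trans (adj-sym G u (c l)) (u-adjacent l l≢i)
... | no  j≢i  | yes refl
  rewrite updateAt-updates i {const u} c | updateAt-minimal j i {const u} c j≢i =
  u-adjacent j j≢i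
... | no  j≢i  | no  l≢i
  rewrite updateAt-minimal j i {const u} c j≢i | updateAt-minimal l i {const u} c l≢i =
  c-clique j l j≢l

-- Complete multipartite graphs

IsCompletePartiteBy : Graph n → (Fin n → Fin k) → Set
IsCompletePartiteBy G p = ∀ u w → adj G u w ≡ not ⌊ p u ≟ p w ⌋

quotient-combine : ∀ a (i : Fin k) (j : Fin a) → quotient a (combine i j) ≡ i
quotient-combine a i j = cong proj₁ (remQuot-combine i j)

completeMultipartite-partite : ∀ k a → IsCompletePartiteBy (completeMultipartite k a) (quotient a)
completeMultipartite-partite k a _ _ = refl

module _ (G : Graph n) {p : Fin n → Fin k} (G-partite : IsCompletePartiteBy G p) where

  nonadjacent⇔sameClass : ∀ u w → adj G u w ≡ false ⇔ p u ≡ p w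
  nonadjacent⇔sameClass u w rewrite G-partite u w with p u ≟ p w
  ... | yes pu≡pw = mk⇔ (const pu≡pw) (const refl)
  ... | no  pu≢pw = mk⇔ (λ ()) (λ pu≡pw → contradiction pu≡pw pu≢pw)

  differentClass⇒adjacent : ∀ {u w} → p u ≢ p w → adj G u w ≡ true
  differentClass⇒adjacent {u} {w} pu≢pw = ¬-not (pu≢pw ∘ Equivalence.to (nonadjacent⇔sameClass u w))

  adjacent⇒differentClass : ∀ {u w} → adj G u w ≡ true → p u ≢ p w
  adjacent⇒differentClass {u} {w} uw-adjacent pu≡pw =
    case trans (sym uw-adjacent) (Equivalence.from (nonadjacent⇔sameClass u w) pu≡pw) of λ ()

  classSize≡coDegree : ∀ u → count (λ w → p w ≟ p u) ≡ coDegree G u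
  classSize≡coDegree u = count-cong λ w →
    mk⇔ (Equivalence.from (nonadjacent⇔sameClass u w) ∘ sym) (sym ∘ Equivalence.to (nonadjacent⇔sameClass u w))

injective⇒strictlySurjective : {f : Fin m → Fin n} → n ≤ m → Injective _≡_ _≡_ f →
                               StrictlySurjective _≡_ f
injective⇒strictlySurjective {n = suc n} {f = f} n≤m f-injective y with any? (λ x → f x ≟ y)
... | yes hit = hit
... | no  ¬hit =
  contradiction (injective⇒≤ (f-injective ∘ punchOut-injective (y≢f _) (y≢f _))) (<⇒≱ n≤m)
  where
  y≢f : ∀ x → y ≢ f x
  y≢f x y≡fx = ¬hit (x , sym y≡fx)

module _ (G : Graph n) {p : Fin n → Fin k} (a : ℕ) (G-partite : IsCompletePartiteBy G p)
         (classSize : ∀ i → count (λ w → p w ≟ i) ≡ a) (order : n ≡ k * a) where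

  rank : Fin n → ℕ
  rank u = count (λ w → (p w ≟ p u) ×-dec (w <? u))

  rank<classSize : ∀ u → rank u < a
  rank<classSize u = <-≤-trans (count-mono-< proj₁ (λ (_ , u<u) → <ᶠ-irrefl refl u<u) refl)
                               (≤-reflexive (classSize (p u)))

  rank-strict : ∀ {u w} → p u ≡ p w → u Fin.< w → rank u < rank w
  rank-strict pu≡pw u<w = count-mono-< (λ (e , x<u) → trans e pu≡pw , <ᶠ-trans x<u u<w)
                                       (λ (_ , u<u) → <ᶠ-irrefl refl u<u) (pu≡pw , u<w)

  rank-injective : ∀ {u w} → p u ≡ p w → rank u ≡ rank w → u ≡ w
  rank-injective {u} {w} pu≡pw ranku≡rankw with <ᶠ-cmp u w
  ... | tri< u<w _ _ = contradiction ranku≡rankw (<⇒≢ (rank-strict pu≡pw u<w))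
  ... | tri≈ _ u≡w _ = u≡w
  ... | tri> _ _ w<u = contradiction (sym ranku≡rankw) (<⇒≢ (rank-strict (sym pu≡pw) w<u))

  embed : Fin n → Fin (k * a)
  embed u = combine (p u) (fromℕ< (rank<classSize u))

  embed-injective : Injective _≡_ _≡_ embed
  embed-injective {u} {w} embed-u≡embed-w with combine-injective (p u) _ (p w) _ embed-u≡embed-w
  ... | pu≡pw , ranks≡ = rank-injective pu≡pw
    (trans (sym (toℕ-fromℕ< _)) (trans (cong toℕ ranks≡) (toℕ-fromℕ< _)))

  quotient-embed : ∀ u → quotient a (embed u) ≡ p u
  quotient-embed u = quotient-combine a (p u) _

  completePartite⇒isomorphic : Isomorphic G (completeMultipartite k a)
  completePartite⇒isomorphic =
    mk⤖ (embed-injective , strictlySurjective⇒surjective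
           (injective⇒strictlySurjective (≤-reflexive (sym order)) embed-injective)) ,
    λ u w → trans (G-partite u w)
                  (cong₂ (λ i j → not ⌊ i ≟ j ⌋) (sym (quotient-embed u)) (sym (quotient-embed w)))

count-quotient : ∀ k a (q : Fin k) → count (λ v → quotient {k} a v ≟ q) ≡ a
count-quotient k a q = begin
  count (λ v → quotient a v ≟ q)
    ≡⟨ count-combine {k} {a} (λ v → quotient a v ≟ q) ⟩
  ∑[ i < k ] count (λ j → quotient a (combine i j) ≟ q)
    ≡⟨ sum-cong-≗ {k} (λ i → count-cong λ j →
         mk⇔ (trans (sym (quotient-combine a i j))) (trans (quotient-combine a i j))) ⟩
  ∑[ i < k ] count (λ (j : Fin a) → i ≟ q)
    ≡⟨ ∑-count-comm (λ i (j : Fin a) → i ≟ q) ⟩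
  ∑[ j < a ] count (_≟ q)
    ≡⟨ sum-cong-≗ {a} (λ _ → count-≡ q) ⟩
  ∑[ j < a ] 1
    ≡⟨ ∑-const a 1 ⟩
  a * 1
    ≡⟨ *-identityʳ a ⟩
  a ∎
  where open ≡-Reasoning

coDegree-completeMultipartite : ∀ k a (v : Fin (k * a)) → coDegree (completeMultipartite k a) v ≡ a
coDegree-completeMultipartite k a v =
  trans (sym (classSize≡coDegree K (completeMultipartite-partite k a) v)) (count-quotient k a (quotient a v))
  where K = completeMultipartite k a

cliqueNumber-completeMultipartite : ∀ k a → 1 ≤ a → CliqueNumber≡ (completeMultipartite k a) k
cliqueNumber-completeMultipartite k (suc a) _ =
  (tabulate transversal , tabulate-isClique K transversal-clique , length-tabulate transversal) ,
  λ vs vs-clique → subst (_≤ k) (length-map part vs) (distinct⇒length≤ (map part vs)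
    (AllPairs.map⁺ (AllPairs.map (adjacent⇒differentClass K K-partite) vs-clique)))
  where
  K = completeMultipartite k (suc a)
  K-partite = completeMultipartite-partite k (suc a)

  part : Fin (k * suc a) → Fin k
  part = quotient (suc a)

  transversal : Fin k → Fin (k * suc a)
  transversal i = combine i zero

  transversal-clique : IsCliqueMap K transversal
  transversal-clique i j i≢j = differentClass⇒adjacent K K-partite λ same-part →
    i≢j (trans (sym (quotient-combine (suc a) i zero)) (trans same-part (quotient-combine (suc a) j zero)))

-- Graphs with clique number k in which every vertex has a non-neighbours

module MaximumClique {n k a} (G : Graph n) (order : n ≡ k * a) (coRegular : ∀ u → coDegree G u ≡ a)
                     (clique-bound : ∀ vs → IsClique G vs → length vs ≤ k) where

  nonNeighbour-exists : {c : Fin k → Fin n} → IsCliqueMap G c → ∀ u → ∃[ i ] adj G (c i) u ≡ false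
  nonNeighbour-exists {c} c-clique u with any? (λ i → adj G (c i) u ≟ᵇ false)
  ... | yes found = found
  ... | no  ¬found =
    contradiction (subst (λ l → suc l ≤ k) (length-tabulate c) (clique-bound _ larger-clique)) (<-irrefl refl)
    where
    larger-clique : IsClique G (u ∷ tabulate c)
    larger-clique = Allₚ.tabulate⁺ (λ i → trans (adj-sym G u (c i)) (¬-not (¬found ∘ (i ,_))))
                  ∷ tabulate-isClique G c-clique

  nonNeighbour-unique : {c : Fin k → Fin n} → IsCliqueMap G c →
                        ∀ {u i j} → adj G (c i) u ≡ false → adj G (c j) u ≡ false → i ≡ j
  nonNeighbour-unique {c} c-clique {u} = count≤1⇒unique (≤-reflexive (sym (exactlyOne u)))
    where
    nonAdjacent? : ∀ i v → Dec (adj G (c i) v ≡ false)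
    nonAdjacent? i v = adj G (c i) v ≟ᵇ false

    total : ∑[ v < n ] count (λ i → nonAdjacent? i v) ≡ ∑[ v < n ] 1
    total = begin
      ∑[ v < n ] count (λ i → nonAdjacent? i v) ≡⟨ ∑-count-comm nonAdjacent? ⟨
      ∑[ i < k ] coDegree G (c i)              ≡⟨ sum-cong-≗ (coRegular ∘ c) ⟩
      ∑[ i < k ] a                             ≡⟨ ∑-const k a ⟩
      k * a                                    ≡⟨ order ⟨
      n                                        ≡⟨ *-identityʳ n ⟨
      n * 1                                    ≡⟨ ∑-const n 1 ⟨
      ∑[ v < n ] 1                             ∎
      where open ≡-Reasoning

    -- Each vertex misses at least one clique vertex, and the double count leaves no room for more.
    exactlyOne : ∀ v → 1 ≡ count (λ i → nonAdjacent? i v)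
    exactlyOne = ∑-≤-rigid (λ v → count-pos (proj₂ (nonNeighbour-exists c-clique v))) (≤-reflexive total)

  module _ {c : Fin k → Fin n} (c-clique : IsCliqueMap G c) where

    class : Fin n → Fin k
    class v = proj₁ (nonNeighbour-exists c-clique v)

    class-nonadjacent : ∀ v → adj G (c (class v)) v ≡ false
    class-nonadjacent v = proj₂ (nonNeighbour-exists c-clique v)

    class-clique : ∀ i → class (c i) ≡ i
    class-clique i = nonNeighbour-unique c-clique (class-nonadjacent (c i)) (adj-irrefl G (c i))

    -- Swapping u into the clique in place of c (class u) gives another k-clique; uniqueness of
    -- non-neighbours in that clique is what decides whether u and w are adjacent.
    exchanged : Fin n → Fin k → Fin n
    exchanged u = updateAt c (class u) (const u)

    exchanged-clique : ∀ u → IsCliqueMap G (exchanged u)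
    exchanged-clique u = exchange-isCliqueMap G c-clique λ j j≢class-u →
      ¬-not (j≢class-u ∘ λ cj-u-nonadjacent →
        nonNeighbour-unique c-clique cj-u-nonadjacent (class-nonadjacent u))

    exchanged-self : ∀ u → exchanged u (class u) ≡ u
    exchanged-self u = updateAt-updates (class u) c

    exchanged-other : ∀ {u i} → i ≢ class u → exchanged u i ≡ c i
    exchanged-other {u} {i} = updateAt-minimal i (class u) c

    sameClass⇒nonadjacent : ∀ {u w} → class u ≡ class w → adj G u w ≡ false
    sameClass⇒nonadjacent {u} {w} same with l , missed ← nonNeighbour-exists (exchanged-clique u) w
      with l ≟ class u
    ... | yes refl      = subst (λ x → adj G x w ≡ false) (exchanged-self u) missed
    ... | no  l≢class-u = contradiction
      (trans (nonNeighbour-unique c-clique cl-w-nonadjacent (class-nonadjacent w)) (sym same)) l≢class-u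
      where
      cl-w-nonadjacent : adj G (c l) w ≡ false
      cl-w-nonadjacent = subst (λ x → adj G x w ≡ false) (exchanged-other l≢class-u) missed

    nonadjacent⇒sameClass : ∀ {u w} → adj G u w ≡ false → class u ≡ class w
    nonadjacent⇒sameClass {u} {w} uw-nonadjacent with class w ≟ class u
    ... | yes same            = sym same
    ... | no  class-w≢class-u = nonNeighbour-unique (exchanged-clique u)
      (subst (λ x → adj G x w ≡ false) (sym (exchanged-self u)) uw-nonadjacent)
      (subst (λ x → adj G x w ≡ false) (sym (exchanged-other class-w≢class-u)) (class-nonadjacent w))

    class-partite : IsCompletePartiteBy G class
    class-partite u w with class u ≟ class w
    ... | yes same      = sameClass⇒nonadjacent same
    ... | no  different = ¬-not (different ∘ nonadjacent⇒sameClass)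

    classSize : ∀ i → count (λ w → class w ≟ i) ≡ a
    classSize i = begin
      count (λ w → class w ≟ i)
        ≡⟨ count-cong (λ w → mk⇔ (λ e → trans e (sym (class-clique i))) (λ e → trans e (class-clique i))) ⟩
      count (λ w → class w ≟ class (c i))
        ≡⟨ classSize≡coDegree G class-partite (c i) ⟩
      coDegree G (c i)
        ≡⟨ coRegular (c i) ⟩
      a ∎
      where open ≡-Reasoning

    isomorphic : Isomorphic G (completeMultipartite k a)
    isomorphic = completePartite⇒isomorphic G a class-partite classSize order

cliqueNumber⇒isomorphic : ∀ k a (G : Graph n) → n ≡ k * a → (∀ u → coDegree G u ≡ a) →
                          CliqueNumber≡ G k → Isomorphic G (completeMultipartite k a)
cliqueNumber⇒isomorphic .(length vs) a G order coRegular ((vs , vs-clique , refl) , clique-bound) =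
  MaximumClique.isomorphic G order coRegular clique-bound (lookup-isCliqueMap G vs-clique)

corollary1 : (k a : ℕ) → 1 ≤ k → 1 ≤ a → {n : ℕ} → (G : Graph n) →
    DegreeEquivalent G (completeMultipartite k a) →
    CliqueNumber≡ G k ⇔ Isomorphic G (completeMultipartite k a)
corollary1 k a _ 1≤a G G≈K = mk⇔
  (cliqueNumber⇒isomorphic k a G (degreeEquivalent⇒order≡ G K G≈K) coRegular)
  (λ G≅K → isomorphic⇒cliqueNumber≡ G K G≅K (cliqueNumber-completeMultipartite k a 1≤a))
  where
  K = completeMultipartite k a

  coRegular : ∀ u → coDegree G u ≡ a
  coRegular u with v , coDegree-u≡coDegree-v ← degreeEquivalent⇒coDegree G K G≈K u =
    trans coDegree-u≡coDegree-v (coDegree-completeMultipartite k a v)
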